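{- Let $G$ be a finite solvable group with chief series $1=N_{0}\subset N_{1}\subset\dots\subset N_{k}=G$. Let $E\subset F$ be subgroups of $G$ with $E$ a maximal subgroup of $F$, and suppose $E\subset F$ is weakly separated by $N_{i+1}/N_{i}$, i.e. $N_{i}\cap E=N_{i}\cap F$ and $N_{i+1}E=N_{i+1}F$. Then $\mathcal{N}_{i}(E)=\mathcal{N}_{i}(F)$.
   Context: For a subgroup $H$ of $G$, $\mathcal{N}_{i}(H)$ denotes the set of all subgroups $K$ of $G$ with $N_{i}\le K\le N_{i+1}$ that are normalized by $H$. -}

module Defs where

open import Level using (Level; _⊔_)
open import Algebra.Bundles using (Group)
open import Data.Nat using (ℕ; suc; _<_)
open import Data.Fin using (Fin)
open import Data.Product using (Σ; ∃; _×_; _,_)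
open import Data.Sum using (_⊎_)
open import Relation.Nullary using (¬_)
open import Relation.Unary using (Pred; _∈_; _⊆_; _∉_)

module GroupDefs {c ℓ : Level} (G : Group c ℓ) where
  open Group G

  Sub : Set (Level.suc (c ⊔ ℓ))
  Sub = Pred Carrier (c ⊔ ℓ)

  IsFinite : Set (c ⊔ ℓ)
  IsFinite = Σ ℕ λ n → Σ (Fin n → Carrier) λ f → ∀ x → ∃ λ i → f i ≈ x

  record IsSubgroup (H : Sub) : Set (c ⊔ ℓ) where
    field
      resp  : ∀ {x y} → x ≈ y → x ∈ H → y ∈ H
      ε∈    : ε ∈ H
      ∙-closed : ∀ {x y} → x ∈ H → y ∈ H → (x ∙ y) ∈ H
      ⁻¹-closed : ∀ {x} → x ∈ H → (x ⁻¹) ∈ H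

  _≐_ : Sub → Sub → Set (c ⊔ ℓ)
  A ≐ B = (A ⊆ B) × (B ⊆ A)

  _⊊_ : Sub → Sub → Set (c ⊔ ℓ)
  A ⊊ B = (A ⊆ B) × ∃ λ x → x ∈ B × x ∉ A

  trivial : Sub
  trivial x = Level.Lift (c ⊔ ℓ) (x ≈ ε)

  whole : Sub
  whole _ = Level.Lift (c ⊔ ℓ) Data.Unit.⊤
    where import Data.Unit

  _∩_ : Sub → Sub → Sub
  (A ∩ B) x = x ∈ A × x ∈ B

  _·_ : Sub → Sub → Sub
  (A · B) x = ∃ λ a → ∃ λ b → a ∈ A × b ∈ B × Level.Lift (c ⊔ ℓ) (x ≈ a ∙ b)

  NormalizedBy : Sub → Sub → Set (c ⊔ ℓ)
  NormalizedBy K H = ∀ {h k} → h ∈ H → k ∈ K → ((h ∙ k) ∙ h ⁻¹) ∈ K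

  IsNormalSubgroup : Sub → Set (c ⊔ ℓ)
  IsNormalSubgroup N = IsSubgroup N × NormalizedBy N whole

  commutator : Carrier → Carrier → Carrier
  commutator x y = ((x ⁻¹ ∙ y ⁻¹) ∙ x) ∙ y

  -- G is solvable: there is a subnormal series 1 = S 0 ⊴ S 1 ⊴ … ⊴ S m = G
  -- with abelian factors S (j+1) / S j
  IsSolvable : Set (Level.suc (c ⊔ ℓ))
  IsSolvable = Σ ℕ λ m → Σ (ℕ → Sub) λ S →
      (S 0 ≐ trivial) × (S m ≐ whole)
    × (∀ j → j < m →
         IsSubgroup (S j) × IsSubgroup (S (suc j)) × (S j ⊆ S (suc j))
       × NormalizedBy (S j) (S (suc j))
       × (∀ {x y} → x ∈ S (suc j) → y ∈ S (suc j) → commutator x y ∈ S j))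

  IsChiefSeries : ℕ → (ℕ → Sub) → Set (Level.suc (c ⊔ ℓ))
  IsChiefSeries k N =
      (N 0 ≐ trivial) × (N k ≐ whole)
    × (∀ j → j < suc k → IsNormalSubgroup (N j))
    × (∀ j → j < k →
          (N j ⊊ N (suc j))
        × (∀ M → IsNormalSubgroup M → N j ⊆ M → M ⊆ N (suc j) →
             (M ⊆ N j) ⊎ (N (suc j) ⊆ M)))

  IsMaximalSubgroupOf : Sub → Sub → Set (Level.suc (c ⊔ ℓ))
  IsMaximalSubgroupOf E F =
      IsSubgroup E × IsSubgroup F × (E ⊊ F)
    × (∀ H → IsSubgroup H → E ⊆ H → H ⊆ F → (H ⊆ E) ⊎ (F ⊆ H))

  WeaklySeparated : (ℕ → Sub) → ℕ → Sub → Sub → Set (c ⊔ ℓ)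
  WeaklySeparated N i E F =
    ((N i ∩ E) ≐ (N i ∩ F)) × ((N (suc i) · E) ≐ (N (suc i) · F))

  𝒩 : (ℕ → Sub) → ℕ → Sub → Sub → Set (c ⊔ ℓ)
  𝒩 N i H K = IsSubgroup K × (N i ⊆ K) × (K ⊆ N (suc i)) × NormalizedBy K H

module Submission where

-- In a solvable group every chief factor N_{i+1}/N_i is abelian: the normal subgroup
-- generated by N_i and [N_{i+1},N_{i+1}] lies between N_i and N_{i+1}, and it cannot be
-- all of N_{i+1}, since a section that is perfect modulo N_i is pushed down the
-- solvable series into N_i. Hence every K with N_i ≤ K ≤ N_{i+1} is normalized by
-- N_{i+1} (conjugating by n multiplies by a commutator lying in N_i), so a K normalized
-- by E is normalized by N_{i+1}E ⊇ F. The converse is E ⊆ F.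

open import Defs
open import Level using (Level; _⊔_; lift; lower)
open import Algebra.Bundles using (Group)
open import Data.Nat using (ℕ; zero; suc; _+_; _<_; s≤s; z≤n)
open import Data.Nat.Properties using (+-suc; +-identityʳ; m<m+n; m<n⇒m<1+n)
open import Data.Product using (_×_; ∃; _,_; proj₁; proj₂)
open import Data.Sum using ([_,_]′)
open import Data.Empty using (⊥-elim)
open import Function using (id)
open import Data.Unit using (tt)
open import Relation.Unary using (_∈_; _⊆_)
open import Relation.Binary.PropositionalEquality as ≡ using (_≡_)

module GroupTheory {c ℓ : Level} (G : Group c ℓ) where
  open Group G
  open GroupDefs G
  open import Algebra.Properties.Group G
  open import Relation.Binary.Reasoning.Setoid setoid

  conj : Carrier → Carrier → Carrier
  conj g x = (g ∙ x) ∙ g ⁻¹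

  conj-∙ : ∀ g x y → conj g (x ∙ y) ≈ conj g x ∙ conj g y
  conj-∙ g x y = sym (begin
    ((g ∙ x) ∙ g ⁻¹) ∙ ((g ∙ y) ∙ g ⁻¹) ≈⟨ assoc _ _ _ ⟩
    (g ∙ x) ∙ (g ⁻¹ ∙ ((g ∙ y) ∙ g ⁻¹)) ≈⟨ ∙-congˡ (∙-congˡ (assoc _ _ _)) ⟩
    (g ∙ x) ∙ (g ⁻¹ ∙ (g ∙ (y ∙ g ⁻¹))) ≈⟨ ∙-congˡ (\\-leftDividesʳ g _) ⟩
    (g ∙ x) ∙ (y ∙ g ⁻¹)               ≈⟨ assoc _ _ _ ⟨
    ((g ∙ x) ∙ y) ∙ g ⁻¹               ≈⟨ ∙-congʳ (assoc _ _ _) ⟩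
    (g ∙ (x ∙ y)) ∙ g ⁻¹               ∎)

  conj-⁻¹ : ∀ g x → conj g (x ⁻¹) ≈ conj g x ⁻¹
  conj-⁻¹ g x = sym (begin
    ((g ∙ x) ∙ g ⁻¹) ⁻¹  ≈⟨ ⁻¹-anti-homo-∙ _ _ ⟩
    g ⁻¹ ⁻¹ ∙ (g ∙ x) ⁻¹ ≈⟨ ∙-cong (⁻¹-involutive g) (⁻¹-anti-homo-∙ g x) ⟩
    g ∙ (x ⁻¹ ∙ g ⁻¹)    ≈⟨ assoc _ _ _ ⟨
    (g ∙ x ⁻¹) ∙ g ⁻¹    ∎)

  conj-ε : ∀ g → conj g ε ≈ ε
  conj-ε g = begin
    (g ∙ ε) ∙ g ⁻¹ ≈⟨ ∙-congʳ (identityʳ g) ⟩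
    g ∙ g ⁻¹       ≈⟨ inverseʳ g ⟩
    ε              ∎

  conj-commutator : ∀ g a b → conj g (commutator a b) ≈ commutator (conj g a) (conj g b)
  conj-commutator g a b = begin
    conj g (((a ⁻¹ ∙ b ⁻¹) ∙ a) ∙ b)                         ≈⟨ conj-∙ g _ _ ⟩
    conj g ((a ⁻¹ ∙ b ⁻¹) ∙ a) ∙ conj g b                    ≈⟨ ∙-congʳ (conj-∙ g _ _) ⟩
    (conj g (a ⁻¹ ∙ b ⁻¹) ∙ conj g a) ∙ conj g b             ≈⟨ ∙-congʳ (∙-congʳ (conj-∙ g _ _)) ⟩
    ((conj g (a ⁻¹) ∙ conj g (b ⁻¹)) ∙ conj g a) ∙ conj g b
      ≈⟨ ∙-congʳ (∙-congʳ (∙-cong (conj-⁻¹ g a) (conj-⁻¹ g b))) ⟩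
    commutator (conj g a) (conj g b)                         ∎

  conj-congˡ : ∀ {g h x} → g ≈ h → conj g x ≈ conj h x
  conj-congˡ g≈h = ∙-cong (∙-congʳ g≈h) (⁻¹-cong g≈h)

  conj-∙-conj : ∀ g h x → conj (g ∙ h) x ≈ conj g (conj h x)
  conj-∙-conj g h x = begin
    ((g ∙ h) ∙ x) ∙ (g ∙ h) ⁻¹     ≈⟨ ∙-cong (assoc g h x) (⁻¹-anti-homo-∙ g h) ⟩
    (g ∙ (h ∙ x)) ∙ (h ⁻¹ ∙ g ⁻¹)  ≈⟨ assoc _ _ _ ⟨
    ((g ∙ (h ∙ x)) ∙ h ⁻¹) ∙ g ⁻¹  ≈⟨ ∙-congʳ (assoc _ _ _) ⟩
    (g ∙ ((h ∙ x) ∙ h ⁻¹)) ∙ g ⁻¹  ∎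

  conj≈∙commutator : ∀ g x → conj g x ≈ x ∙ commutator x (g ⁻¹)
  conj≈∙commutator g x = sym (begin
    x ∙ (((x ⁻¹ ∙ g ⁻¹ ⁻¹) ∙ x) ∙ g ⁻¹) ≈⟨ assoc _ _ _ ⟨
    (x ∙ ((x ⁻¹ ∙ g ⁻¹ ⁻¹) ∙ x)) ∙ g ⁻¹ ≈⟨ ∙-congʳ (assoc _ _ _) ⟨
    ((x ∙ (x ⁻¹ ∙ g ⁻¹ ⁻¹)) ∙ x) ∙ g ⁻¹ ≈⟨ ∙-congʳ (∙-congʳ (\\-leftDividesˡ x _)) ⟩
    (g ⁻¹ ⁻¹ ∙ x) ∙ g ⁻¹                ≈⟨ ∙-congʳ (∙-congʳ (⁻¹-involutive g)) ⟩
    (g ∙ x) ∙ g ⁻¹                      ∎)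

  commutator-closed : ∀ {H} → IsSubgroup H → ∀ {a b} → a ∈ H → b ∈ H → commutator a b ∈ H
  commutator-closed H≤ a∈ b∈ = ∙-closed (∙-closed (∙-closed (⁻¹-closed a∈) (⁻¹-closed b∈)) a∈) b∈
    where open IsSubgroup H≤

  conj-preimage-isSubgroup : ∀ {H} g → IsSubgroup H → IsSubgroup (λ x → conj g x ∈ H)
  conj-preimage-isSubgroup {H} g H≤ = record
    { resp      = λ x≈y → resp (∙-congʳ (∙-congˡ x≈y))
    ; ε∈        = resp (sym (conj-ε g)) ε∈
    ; ∙-closed  = λ x∈ y∈ → resp (sym (conj-∙ g _ _)) (∙-closed x∈ y∈)
    ; ⁻¹-closed = λ x∈ → resp (sym (conj-⁻¹ g _)) (⁻¹-closed x∈)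
    }
    where open IsSubgroup H≤

  ⊆-· : ∀ {A B} → ε ∈ A → B ⊆ A · B
  ⊆-· ε∈A {x} x∈B = ε , x , ε∈A , x∈B , lift (sym (identityˡ x))

  normalizedBy-· : ∀ {K A B} → IsSubgroup K → NormalizedBy K A → NormalizedBy K B →
                   NormalizedBy K (A · B)
  normalizedBy-· K≤ nA nB (a , b , a∈ , b∈ , lift h≈ab) k∈ =
    IsSubgroup.resp K≤ (sym (trans (conj-congˡ h≈ab) (conj-∙-conj a b _))) (nA a∈ (nB b∈ k∈))

  normalizedBy-of-commutator∈ : ∀ {K B} → IsSubgroup K → IsSubgroup B →
    (∀ {k b} → k ∈ K → b ∈ B → commutator k b ∈ K) → NormalizedBy K B
  normalizedBy-of-commutator∈ K≤ B≤ [K,B]⊆K {h} {k} h∈ k∈ =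
    resp (sym (conj≈∙commutator h k)) (∙-closed k∈ ([K,B]⊆K k∈ (IsSubgroup.⁻¹-closed B≤ h∈)))
    where open IsSubgroup K≤

  data ⟨_∪[_,_]⟩ (A B C : Sub) : Carrier → Set (c ⊔ ℓ) where
    incl        : ∀ {x} → x ∈ A → ⟨ A ∪[ B , C ]⟩ x
    commutator∈ : ∀ {b c} → b ∈ B → c ∈ C → ⟨ A ∪[ B , C ]⟩ (commutator b c)
    ε∈          : ⟨ A ∪[ B , C ]⟩ ε
    ∙-closed    : ∀ {x y} → ⟨ A ∪[ B , C ]⟩ x → ⟨ A ∪[ B , C ]⟩ y → ⟨ A ∪[ B , C ]⟩ (x ∙ y)
    ⁻¹-closed   : ∀ {x} → ⟨ A ∪[ B , C ]⟩ x → ⟨ A ∪[ B , C ]⟩ (x ⁻¹)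
    resp        : ∀ {x y} → x ≈ y → ⟨ A ∪[ B , C ]⟩ x → ⟨ A ∪[ B , C ]⟩ y

  module _ {A B C : Sub} where

    ⟨∪[,]⟩-isSubgroup : IsSubgroup ⟨ A ∪[ B , C ]⟩
    ⟨∪[,]⟩-isSubgroup = record
      { resp = resp ; ε∈ = ε∈ ; ∙-closed = ∙-closed ; ⁻¹-closed = ⁻¹-closed }

    ⟨∪[,]⟩-least : ∀ {H : Sub} → IsSubgroup H → A ⊆ H →
      (∀ {b c} → b ∈ B → c ∈ C → commutator b c ∈ H) → ⟨ A ∪[ B , C ]⟩ ⊆ H
    ⟨∪[,]⟩-least {H} H≤ A⊆H [B,C]⊆H = go
      where
      module H = IsSubgroup H≤
      go : ⟨ A ∪[ B , C ]⟩ ⊆ H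
      go (incl x∈)           = A⊆H x∈
      go (commutator∈ b∈ c∈) = [B,C]⊆H b∈ c∈
      go ε∈                  = H.ε∈
      go (∙-closed x∈ y∈)    = H.∙-closed (go x∈) (go y∈)
      go (⁻¹-closed x∈)      = H.⁻¹-closed (go x∈)
      go (resp x≈y x∈)       = H.resp x≈y (go x∈)

    ⟨∪[,]⟩-normal : NormalizedBy A whole → NormalizedBy B whole → NormalizedBy C whole →
      NormalizedBy ⟨ A ∪[ B , C ]⟩ whole
    ⟨∪[,]⟩-normal A⊴ B⊴ C⊴ {g} _ =
      ⟨∪[,]⟩-least (conj-preimage-isSubgroup g ⟨∪[,]⟩-isSubgroup)
        (λ x∈ → incl (A⊴ (lift tt) x∈))
        (λ b∈ c∈ → resp (sym (conj-commutator g _ _))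
                        (commutator∈ (B⊴ (lift tt) b∈) (C⊴ (lift tt) c∈)))

    ⟨∪[,]⟩-⊆ : ∀ {H} → IsSubgroup H → A ⊆ H → B ⊆ H → C ⊆ H → ⟨ A ∪[ B , C ]⟩ ⊆ H
    ⟨∪[,]⟩-⊆ H≤ A⊆H B⊆H C⊆H =
      ⟨∪[,]⟩-least H≤ A⊆H (λ b∈ c∈ → commutator-closed H≤ (B⊆H b∈) (C⊆H c∈))

  module Modulo {A : Sub} (A⊴G : IsNormalSubgroup A) where
    private
      module A = IsSubgroup (proj₁ A⊴G)

    infix 4 _~_
    _~_ : Carrier → Carrier → Set (c ⊔ ℓ)
    x ~ y = x ∙ y ⁻¹ ∈ A

    ≈⇒~ : ∀ {x y} → x ≈ y → x ~ y
    ≈⇒~ x≈y = A.resp (sym (x≈y⇒x∙y⁻¹≈ε x≈y)) A.ε∈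

    ∈⇔~ε : ∀ {x} → (x ∈ A → x ~ ε) × (x ~ ε → x ∈ A)
    ∈⇔~ε {x} = A.resp (sym x∙ε⁻¹≈x) , A.resp x∙ε⁻¹≈x
      where
      x∙ε⁻¹≈x : x ∙ ε ⁻¹ ≈ x
      x∙ε⁻¹≈x = trans (∙-congˡ ε⁻¹≈ε) (identityʳ x)

    ~-trans : ∀ {x y z} → x ~ y → y ~ z → x ~ z
    ~-trans {x} {y} {z} x~y y~z = A.resp (begin
      (x ∙ y ⁻¹) ∙ (y ∙ z ⁻¹) ≈⟨ assoc _ _ _ ⟩
      x ∙ (y ⁻¹ ∙ (y ∙ z ⁻¹)) ≈⟨ ∙-congˡ (\\-leftDividesʳ y (z ⁻¹)) ⟩
      x ∙ z ⁻¹                ∎) (A.∙-closed x~y y~z)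

    ~-∙ : ∀ {x x′ y y′} → x ~ x′ → y ~ y′ → x ∙ y ~ x′ ∙ y′
    ~-∙ {x} {x′} {y} {y′} x~x′ y~y′ = A.resp (begin
      conj x (y ∙ y′ ⁻¹) ∙ (x ∙ x′ ⁻¹)          ≈⟨ assoc _ _ _ ⟩
      (x ∙ (y ∙ y′ ⁻¹)) ∙ (x ⁻¹ ∙ (x ∙ x′ ⁻¹))  ≈⟨ ∙-congˡ (\\-leftDividesʳ x (x′ ⁻¹)) ⟩
      (x ∙ (y ∙ y′ ⁻¹)) ∙ x′ ⁻¹                 ≈⟨ ∙-congʳ (assoc _ _ _) ⟨
      ((x ∙ y) ∙ y′ ⁻¹) ∙ x′ ⁻¹                 ≈⟨ assoc _ _ _ ⟩
      (x ∙ y) ∙ (y′ ⁻¹ ∙ x′ ⁻¹)                 ≈⟨ ∙-congˡ (⁻¹-anti-homo-∙ x′ y′) ⟨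
      (x ∙ y) ∙ (x′ ∙ y′) ⁻¹                    ∎) (A.∙-closed (proj₂ A⊴G (lift tt) y~y′) x~x′)

    ~-⁻¹ : ∀ {x x′} → x ~ x′ → x ⁻¹ ~ x′ ⁻¹
    ~-⁻¹ {x} {x′} x~x′ = A.resp (begin
      conj (x ⁻¹) ((x ∙ x′ ⁻¹) ⁻¹)          ≈⟨ ∙-congʳ (∙-congˡ (⁻¹-anti-homo-∙ x (x′ ⁻¹))) ⟩
      (x ⁻¹ ∙ (x′ ⁻¹ ⁻¹ ∙ x ⁻¹)) ∙ x ⁻¹ ⁻¹  ≈⟨ ∙-congʳ (assoc _ _ _) ⟨
      ((x ⁻¹ ∙ x′ ⁻¹ ⁻¹) ∙ x ⁻¹) ∙ x ⁻¹ ⁻¹  ≈⟨ //-rightDividesʳ (x ⁻¹) _ ⟩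
      x ⁻¹ ∙ x′ ⁻¹ ⁻¹                       ∎) (proj₂ A⊴G (lift tt) (A.⁻¹-closed x~x′))

    ~-commutator : ∀ {x x′ y y′} → x ~ x′ → y ~ y′ → commutator x y ~ commutator x′ y′
    ~-commutator x~x′ y~y′ = ~-∙ (~-∙ (~-∙ (~-⁻¹ x~x′) (~-⁻¹ y~y′)) x~x′) y~y′

    Saturation : Sub → Sub
    Saturation S x = ∃ λ s → s ∈ S × x ~ s

    saturation-isSubgroup : ∀ {S} → IsSubgroup S → IsSubgroup (Saturation S)
    saturation-isSubgroup S≤ = record
      { resp      = λ x≈y (s , s∈ , x~s) → s , s∈ , ~-trans (≈⇒~ (sym x≈y)) x~s
      ; ε∈        = ε , S.ε∈ , ≈⇒~ refl
      ; ∙-closed  = λ (s , s∈ , x~s) (t , t∈ , y~t) → s ∙ t , S.∙-closed s∈ t∈ , ~-∙ x~s y~t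
      ; ⁻¹-closed = λ (s , s∈ , x~s) → s ⁻¹ , S.⁻¹-closed s∈ , ~-⁻¹ x~s
      }
      where module S = IsSubgroup S≤

    -- Saturation T is A·T. If B is perfect modulo A, B ⊆ A·T forces B ⊆ A·[T,T].
    saturation-descends : ∀ {B T U} → B ⊆ ⟨ A ∪[ B , B ]⟩ → IsSubgroup U →
      (∀ {s t} → s ∈ T → t ∈ T → commutator s t ∈ U) →
      B ⊆ Saturation T → B ⊆ Saturation U
    saturation-descends B⊆⟨A∪[B,B]⟩ U≤ [T,T]⊆U B⊆AT x∈B =
      ⟨∪[,]⟩-least (saturation-isSubgroup U≤)
        (λ a∈ → ε , IsSubgroup.ε∈ U≤ , proj₁ ∈⇔~ε a∈)
        (λ b∈ b′∈ → let (s , s∈ , b~s) = B⊆AT b∈ ; (t , t∈ , b′~t) = B⊆AT b′∈ in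
           commutator s t , [T,T]⊆U s∈ t∈ , ~-commutator b~s b′~t)
        (B⊆⟨A∪[B,B]⟩ x∈B)

  -- Downward induction along the solvable series, from B ⊆ A·Sₘ = G to B ⊆ A·S₀ = A.
  perfect-modulo⇒⊆ : IsSolvable → ∀ {A B} → IsNormalSubgroup A →
    B ⊆ ⟨ A ∪[ B , B ]⟩ → B ⊆ A
  perfect-modulo⇒⊆ (m , S , S₀≐1 , Sₘ≐G , series) {A} {B} A⊴G B⊆⟨A∪[B,B]⟩ x∈B =
    let s , s∈S₀ , x~s = descend m 0 ≡.refl x∈B
    in proj₂ ∈⇔~ε (~-trans x~s (≈⇒~ (lower (proj₁ S₀≐1 s∈S₀))))
    where
    open Modulo A⊴G
    descend : ∀ t j → j + t ≡ m → B ⊆ Saturation (S j)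
    descend zero j j+0≡m {x} _ =
      x , ≡.subst (λ j → x ∈ S j) (≡.sym (≡.trans (≡.sym (+-identityʳ j)) j+0≡m))
                  (proj₂ Sₘ≐G (lift tt)) , ≈⇒~ refl
    descend (suc t) j j+1+t≡m = saturation-descends B⊆⟨A∪[B,B]⟩ Sj≤ [S,S]⊆Sj
        (descend t (suc j) (≡.trans (≡.sym (+-suc j t)) j+1+t≡m))
      where
      j<m : j < m
      j<m = ≡.subst (j <_) j+1+t≡m (m<m+n j (s≤s z≤n))
      Sj≤ : IsSubgroup (S j)
      Sj≤ = proj₁ (series j j<m)
      [S,S]⊆Sj : ∀ {s t} → s ∈ S (suc j) → t ∈ S (suc j) → commutator s t ∈ S j
      [S,S]⊆Sj = proj₂ (proj₂ (proj₂ (proj₂ (series j j<m))))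

  chiefFactor-commutator∈ : IsSolvable → ∀ {k N} → IsChiefSeries k N → ∀ {i} → i < k →
    ∀ {a b} → a ∈ N (suc i) → b ∈ N (suc i) → commutator a b ∈ N i
  chiefFactor-commutator∈ solvable {N = N} (_ , _ , normal , steps) {i} i<k a∈ b∈
    with steps i i<k
  ... | (Nᵢ⊆Nᵢ₊₁ , x , x∈Nᵢ₊₁ , x∉Nᵢ) , noNormalBetween =
    [ (λ M⊆Nᵢ → M⊆Nᵢ (commutator∈ a∈ b∈))
    , (λ (Nᵢ₊₁⊆M : N (suc i) ⊆ M) → ⊥-elim (x∉Nᵢ (perfect-modulo⇒⊆ solvable Nᵢ⊴G Nᵢ₊₁⊆M x∈Nᵢ₊₁)))
    ]′ (noNormalBetween M M⊴G incl M⊆Nᵢ₊₁)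
    where
    Nᵢ⊴G : IsNormalSubgroup (N i)
    Nᵢ⊴G = normal i (m<n⇒m<1+n i<k)
    Nᵢ₊₁⊴G : IsNormalSubgroup (N (suc i))
    Nᵢ₊₁⊴G = normal (suc i) (s≤s i<k)
    M : Sub
    M = ⟨ N i ∪[ N (suc i) , N (suc i) ]⟩
    M⊴G : IsNormalSubgroup M
    M⊴G = ⟨∪[,]⟩-isSubgroup , ⟨∪[,]⟩-normal (proj₂ Nᵢ⊴G) (proj₂ Nᵢ₊₁⊴G) (proj₂ Nᵢ₊₁⊴G)
    M⊆Nᵢ₊₁ : M ⊆ N (suc i)
    M⊆Nᵢ₊₁ = ⟨∪[,]⟩-⊆ (proj₁ Nᵢ₊₁⊴G) Nᵢ⊆Nᵢ₊₁ id id

mainTheorem4 : {c ℓ : Level} (G : Group c ℓ) → let open GroupDefs G in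
    IsFinite → IsSolvable →
    (k : ℕ) (N : ℕ → Sub) → IsChiefSeries k N →
    (E F : Sub) → IsMaximalSubgroupOf E F →
    (i : ℕ) → i < k → WeaklySeparated N i E F →
    ∀ K → (𝒩 N i E K → 𝒩 N i F K) × (𝒩 N i F K → 𝒩 N i E K)
mainTheorem4 G _ solvable k N chief E F (_ , _ , (E⊆F , _) , _) i i<k (_ , _ , N·F⊆N·E) K =
  E→F , F→E
  where
  open GroupDefs G
  open GroupTheory G

  Nᵢ₊₁≤ : IsSubgroup (N (suc i))
  Nᵢ₊₁≤ = proj₁ (proj₁ (proj₂ (proj₂ chief)) (suc i) (s≤s i<k))

  E→F : 𝒩 N i E K → 𝒩 N i F K
  E→F (K≤ , Nᵢ⊆K , K⊆Nᵢ₊₁ , K⊴E) = K≤ , Nᵢ⊆K , K⊆Nᵢ₊₁ ,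
    λ h∈F → normalizedBy-· K≤ K⊴Nᵢ₊₁ K⊴E (N·F⊆N·E (⊆-· (IsSubgroup.ε∈ Nᵢ₊₁≤) h∈F))
    where
    K⊴Nᵢ₊₁ : NormalizedBy K (N (suc i))
    K⊴Nᵢ₊₁ = normalizedBy-of-commutator∈ K≤ Nᵢ₊₁≤
      (λ k∈ b∈ → Nᵢ⊆K (chiefFactor-commutator∈ solvable chief i<k (K⊆Nᵢ₊₁ k∈) b∈))

  F→E : 𝒩 N i F K → 𝒩 N i E K
  F→E (K≤ , Nᵢ⊆K , K⊆Nᵢ₊₁ , K⊴F) = K≤ , Nᵢ⊆K , K⊆Nᵢ₊₁ , λ h∈E → K⊴F (E⊆F h∈E)
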